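{- Let $\alpha<\beta<\gamma$ be distinct primes, let $G=\langle a\rangle$ be a cyclic group of order $\alpha^2\beta^2\gamma^2$, and let $C=\{x\in G : |x|\in\{\alpha^2,\beta^2,\gamma^2\}\}$. Let $Cay_{p^2}(G,C)$ be the simple undirected graph with vertex set $G$ in which two distinct vertices $x,y$ are adjacent if and only if $xy^{ -1}\in C$. Then the diameter of $Cay_{p^2}(G,C)$ is $6$.
   Context: $|x|$ denotes the order of the element $x$ in $G$. The diameter of a connected graph is the maximum, over pairs of vertices, of the length of a shortest path between them. -}

module Defs where

open import Level using (0ℓ)
open import Data.Nat using (ℕ; zero; suc; _+_; _*_; _≤_; _<_; _^_)
open import Data.Integer as ℤ using (ℤ; +_; _-_)
open import Data.Integer.Divisibility as ℤd using ()
open import Data.Fin using (Fin; toℕ)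
open import Data.Product using (Σ; ∃; _×_)
open import Data.Sum using (_⊎_)
open import Relation.Binary.PropositionalEquality using (_≡_; _≢_)

_≡_[mod_] : ℤ → ℤ → ℕ → Set
a ≡ b [mod N ] = (+ N) ℤd.∣ (a - b)

-- Model of the cyclic group G = ⟨a⟩ of order N: the element a^i is
-- represented by i : Fin N (so i ∈ {0,…,N-1}); the group law is addition
-- of exponents modulo N.
ZN : ℕ → Set
ZN N = Fin N

-- z represents x·y⁻¹ in G  (i.e. a^z = a^x · (a^y)⁻¹).
IsQuot : (N : ℕ) → ZN N → ZN N → ZN N → Set
IsQuot N x y z = (+ toℕ z) ≡ ((+ toℕ x) - (+ toℕ y)) [mod N ]

PowIsId : (N : ℕ) → ZN N → ℕ → Set
PowIsId N x k = (+ (k * toℕ x)) ≡ (+ 0) [mod N ]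

HasOrder : (N : ℕ) → ZN N → ℕ → Set
HasOrder N x k = (0 < k) × PowIsId N x k
               × (∀ j → 0 < j → PowIsId N x j → k ≤ j)

InC : (α β γ : ℕ) → (N : ℕ) → ZN N → Set
InC α β γ N x = ∃ λ k → (k ≡ α ^ 2 ⊎ k ≡ β ^ 2 ⊎ k ≡ γ ^ 2) × HasOrder N x k

CayAdj : (α β γ : ℕ) → (N : ℕ) → ZN N → ZN N → Set
CayAdj α β γ N x y = (x ≢ y) × ∃ λ z → InC α β γ N z × IsQuot N x y z

data Walk {V : Set} (Adj : V → V → Set) : V → V → ℕ → Set where
  here  : ∀ {x} → Walk Adj x x zero
  there : ∀ {x y z n} → Adj x y → Walk Adj y z n → Walk Adj x z (suc n)

HasDiameter : {V : Set} → (V → V → Set) → ℕ → Set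
HasDiameter {V} Adj d =
  (∀ x y → ∃ λ m → m ≤ d × Walk Adj x y m)
  × (Σ V λ x → Σ V λ y → ∀ m → Walk Adj x y m → d ≤ m)

-- Via ℤ/N ≅ ℤ/α² × ℤ/β² × ℤ/γ², an element has order p² exactly when it is a unit in the
-- p-component and zero in the other two, so along an edge exactly one component changes, by a unit.
-- In ℤ/p² with the units as steps, 0 is at distance 0, the units at distance 1 and the nonzero
-- multiples of p at distance 2. The sum Φ of these three distances grows by at most 1 along an edge,
-- and Φ(0) = 0, Φ(αβγ) = 6. Conversely, by Bézout every difference x - y is a sum of multiples
-- (N/p²)·T of the cofactors, and (N/p²)·T is the quotient of one edge if p ∤ T and of two edges,
-- (N/p²)·1 and (N/p²)·(T - 1), if p ∣ T; this gives a walk of length at most 2 + 2 + 2.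

module Submission where

open import Defs
open import Data.Nat
  using (ℕ; zero; suc; _+_; _*_; _^_; _≤_; _<_; z≤n; s≤s; NonZero; nonTrivial⇒n>1; >-nonZero; >-nonZero⁻¹)
open import Data.Nat.Properties
  using (≤-refl; ≤-reflexive; ≤-trans; <-trans; <⇒≱; +-identityʳ; +-suc; +-mono-≤; +-monoʳ-≤;
         *-assoc; *-comm; *-identityʳ; m*n≢0; m^n≢0; m^n>0; ^-monoʳ-<; ^-identityʳ; module ≤-Reasoning)
open import Data.Nat.Divisibility
  using (_∣_; divides; ∣-refl; ∣-trans; m∣m*n; n∣m*n; *-monoʳ-∣; *-monoˡ-∣; *-cancelˡ-∣; ∣⇒≤)
open import Data.Nat.Coprimality
  using (Coprime; coprime-divisor; coprime-Bézout; 1-coprimeTo; prime⇒coprime)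
  renaming (sym to coprime-sym)
open import Data.Nat.GCD using (module Bézout)
open import Data.Nat.Primality using (Prime; prime⇒irreducible; prime⇒nonZero; prime⇒nonTrivial)
import Data.Nat.Tactic.RingSolver as ℕ-Solver
open import Data.Integer as ℤ using (ℤ; +_; 0ℤ; 1ℤ)
import Data.Integer.Properties as ℤᵖ
open import Data.Integer.DivMod using (_%ℕ_; _/ℕ_; n%ℕd<d; a≡a%ℕn+[a/ℕn]*n)
open import Data.Integer.Divisibility.Signed as ℤ∣
  using () renaming (_∣_ to _∣ᶻ_; _∣?_ to _∣ᶻ?_)
open import Data.Integer.Tactic.RingSolver using (solve-∀)
open import Data.Fin using (Fin; toℕ; fromℕ<)
open import Data.Fin.Properties using (toℕ-fromℕ<)
open import Data.Bool using (true; false; if_then_else_)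
open import Data.Product using (_×_; _,_; proj₁; proj₂; uncurry; ∃-syntax)
open import Data.Sum using (inj₁; inj₂)
open import Function using (_∘_)
open import Function.Bundles using (mk⇔)
open import Relation.Nullary using (¬_; does; yes; no; contradiction)
open import Relation.Nullary.Decidable using (dec-true; dec-false; does-⇔)
open import Relation.Binary.PropositionalEquality
  using (_≡_; _≢_; refl; sym; trans; cong; cong₂; subst; module ≡-Reasoning)

private
  variable
    m n o p e : ℕ
    a b c d : ℤ

coprime-*ˡ : Coprime m o → Coprime n o → Coprime (m * n) o
coprime-*ˡ {m} m⊥o n⊥o (d∣mn , d∣o) = n⊥o (coprime-divisor d⊥m d∣mn , d∣o)
  where
    d⊥m : Coprime _ m
    d⊥m (c∣d , c∣m) = m⊥o (c∣m , ∣-trans c∣d d∣o)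

coprime-*ʳ : Coprime m n → Coprime m o → Coprime m (n * o)
coprime-*ʳ m⊥n m⊥o = coprime-sym (coprime-*ˡ (coprime-sym m⊥n) (coprime-sym m⊥o))

coprime-^ˡ : ∀ k → Coprime m n → Coprime (m ^ k) n
coprime-^ˡ zero    _   = 1-coprimeTo _
coprime-^ˡ (suc k) m⊥n = coprime-*ˡ m⊥n (coprime-^ˡ k m⊥n)

coprime-^ʳ : ∀ k → Coprime m n → Coprime m (n ^ k)
coprime-^ʳ k m⊥n = coprime-sym (coprime-^ˡ k (coprime-sym m⊥n))

coprime⇒*∣ : Coprime m n → m ∣ o → n ∣ o → m * n ∣ o
coprime⇒*∣ {m} {n} m⊥n m∣o (divides c refl) =
  *-monoˡ-∣ n (coprime-divisor m⊥n (subst (m ∣_) (*-comm c n) m∣o))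

∤⇒coprime : Prime p → ¬ p ∣ n → Coprime p n
∤⇒coprime p-prime p∤n (d∣p , d∣n) with prime⇒irreducible p-prime d∣p
... | inj₁ d≡1 = d≡1
... | inj₂ refl = contradiction d∣n p∤n

coprime⇒∤ : Prime p → Coprime p n → ¬ p ∣ n
coprime⇒∤ {p} p-prime p⊥n p∣n = <⇒≱ (nonTrivial⇒n>1 p {{prime⇒nonTrivial p-prime}})
  (≤-reflexive (p⊥n (∣-refl , p∣n)))

p<p^2 : Prime p → p < p ^ 2
p<p^2 {p} p-prime = subst (_< p ^ 2) (^-identityʳ p)
  (^-monoʳ-< p (nonTrivial⇒n>1 p {{prime⇒nonTrivial p-prime}}) {1} {2} ≤-refl)

1+kl≡xy⇒xy-kl≡1 : ∀ {x y k l} → 1 + k * l ≡ x * y → + x ℤ.* + y ℤ.- + k ℤ.* + l ≡ 1ℤ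
1+kl≡xy⇒xy-kl≡1 {x} {y} {k} {l} eq = begin
  + x ℤ.* + y ℤ.- + k ℤ.* + l       ≡⟨ cong₂ ℤ._-_ (ℤᵖ.pos-* x y) (ℤᵖ.pos-* k l) ⟨
  + (x * y) ℤ.- + (k * l)           ≡⟨ cong (λ t → + t ℤ.- + (k * l)) eq ⟨
  + (1 + k * l) ℤ.- + (k * l)       ≡⟨ cong (ℤ._- + (k * l)) (ℤᵖ.pos-+ 1 (k * l)) ⟩
  + 1 ℤ.+ + (k * l) ℤ.- + (k * l)   ≡⟨ [1+i]-i≡1 (+ (k * l)) ⟩
  1ℤ                                ∎
  where
    open ≡-Reasoning
    [1+i]-i≡1 : ∀ i → + 1 ℤ.+ i ℤ.- i ≡ + 1
    [1+i]-i≡1 = solve-∀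

bézout : Coprime m n → ∃[ u ] ∃[ v ] u ℤ.* + m ℤ.+ v ℤ.* + n ≡ 1ℤ
bézout {m} {n} m⊥n with coprime-Bézout m⊥n
... | Bézout.+- x y eq =
  + x , ℤ.- + y , trans (+-neg (+ x) (+ m) (+ y) (+ n)) (1+kl≡xy⇒xy-kl≡1 {x} {m} {y} {n} eq)
  where
    +-neg : ∀ x m y n → x ℤ.* m ℤ.+ ℤ.- y ℤ.* n ≡ x ℤ.* m ℤ.- y ℤ.* n
    +-neg = solve-∀
... | Bézout.-+ x y eq =
  ℤ.- + x , + y , trans (neg-+ (+ x) (+ m) (+ y) (+ n)) (1+kl≡xy⇒xy-kl≡1 {y} {n} {x} {m} eq)
  where
    neg-+ : ∀ x m y n → ℤ.- x ℤ.* m ℤ.+ y ℤ.* n ≡ y ℤ.* n ℤ.- x ℤ.* m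
    neg-+ = solve-∀

cofactor-decomposition : Coprime m (n * o) → Coprime n o → ∀ d →
  ∃[ i ] ∃[ j ] ∃[ k ] d ≡ + (n * o) ℤ.* i ℤ.+ + (m * o) ℤ.* j ℤ.+ + (m * n) ℤ.* k
cofactor-decomposition {m} {n} {o} m⊥no n⊥o d
  with u₁ , v₁ , eq₁ ← bézout m⊥no | u₂ , v₂ , eq₂ ← bézout n⊥o
  = i , j , k , (begin
    d                                                        ≡⟨ d≡d*1*1 d ⟩
    d ℤ.* 1ℤ ℤ.* 1ℤ                                          ≡⟨ cong₂ (λ s t → d ℤ.* s ℤ.* t) eq₁ eq₂ ⟨
    d ℤ.* (u₁ ℤ.* A ℤ.+ v₁ ℤ.* + (n * o)) ℤ.* (u₂ ℤ.* B ℤ.+ v₂ ℤ.* C)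
      ≡⟨ cong (λ t → d ℤ.* (u₁ ℤ.* A ℤ.+ v₁ ℤ.* t) ℤ.* (u₂ ℤ.* B ℤ.+ v₂ ℤ.* C)) (ℤᵖ.pos-* n o) ⟩
    d ℤ.* (u₁ ℤ.* A ℤ.+ v₁ ℤ.* (B ℤ.* C)) ℤ.* (u₂ ℤ.* B ℤ.+ v₂ ℤ.* C)
      ≡⟨ expand d u₁ v₁ u₂ v₂ A B C ⟩
    B ℤ.* C ℤ.* i ℤ.+ A ℤ.* C ℤ.* j ℤ.+ A ℤ.* B ℤ.* k
      ≡⟨ cong₂ ℤ._+_ (cong₂ ℤ._+_ (cong (ℤ._* i) (ℤᵖ.pos-* n o)) (cong (ℤ._* j) (ℤᵖ.pos-* m o)))
                     (cong (ℤ._* k) (ℤᵖ.pos-* m n)) ⟨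
    + (n * o) ℤ.* i ℤ.+ + (m * o) ℤ.* j ℤ.+ + (m * n) ℤ.* k  ∎)
  where
    open ≡-Reasoning
    A = + m
    B = + n
    C = + o
    i = d ℤ.* v₁ ℤ.* (u₂ ℤ.* B ℤ.+ v₂ ℤ.* C)
    j = d ℤ.* u₁ ℤ.* v₂
    k = d ℤ.* u₁ ℤ.* u₂
    d≡d*1*1 : ∀ d → d ≡ d ℤ.* + 1 ℤ.* + 1
    d≡d*1*1 = solve-∀
    expand : ∀ d u₁ v₁ u₂ v₂ A B C →
      d ℤ.* (u₁ ℤ.* A ℤ.+ v₁ ℤ.* (B ℤ.* C)) ℤ.* (u₂ ℤ.* B ℤ.+ v₂ ℤ.* C)
        ≡ B ℤ.* C ℤ.* (d ℤ.* v₁ ℤ.* (u₂ ℤ.* B ℤ.+ v₂ ℤ.* C))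
          ℤ.+ A ℤ.* C ℤ.* (d ℤ.* u₁ ℤ.* v₂) ℤ.+ A ℤ.* B ℤ.* (d ℤ.* u₁ ℤ.* u₂)
    expand = solve-∀

WalkWithin : {V : Set} → (V → V → Set) → ℕ → V → V → Set
WalkWithin Adj k x y = ∃[ m ] m ≤ k × Walk Adj x y m

module _ {V : Set} {Adj : V → V → Set} where

  _++ʷ_ : ∀ {x y z m n} → Walk Adj x y m → Walk Adj y z n → Walk Adj x z (m + n)
  here      ++ʷ w = w
  there a v ++ʷ w = there a (v ++ʷ w)

  within-++ : ∀ {i j x y z} → WalkWithin Adj i x y → WalkWithin Adj j y z → WalkWithin Adj (i + j) x z
  within-++ (m , m≤i , v) (n , n≤j , w) = m + n , +-mono-≤ m≤i n≤j , v ++ʷ w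

  walk-potential : (Φ : V → ℕ) → (∀ {x y} → Adj x y → Φ y ≤ suc (Φ x)) →
                   ∀ {x y m} → Walk Adj x y m → Φ y ≤ m + Φ x
  walk-potential Φ step here = ≤-refl
  walk-potential Φ step {x} (there {n = n} a w) = ≤-trans (walk-potential Φ step w)
    (≤-trans (+-monoʳ-≤ n (step a)) (≤-reflexive (+-suc n (Φ x))))

[i+j]-i≡j : ∀ i j → i ℤ.+ j ℤ.- i ≡ j
[i+j]-i≡j = solve-∀

e∣[t+eT]-t : ∀ {e} t T → + e ∣ᶻ t ℤ.+ + e ℤ.* T ℤ.- t
e∣[t+eT]-t {e} t T = subst (+ e ∣ᶻ_) (sym ([i+j]-i≡j t (+ e ℤ.* T))) (ℤ∣.∣m⇒∣m*n T ℤ∣.∣-refl)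

δ : ∀ {N} → Fin N → Fin N → ℤ
δ x y = + toℕ x ℤ.- + toℕ y

module Modulo (N : ℕ) where

  infix 4 _≈_
  -- A record rather than a definition, so that a and b can be inferred from a proof of a ≈ b.
  record _≈_ (a b : ℤ) : Set where
    constructor mk≈
    field N∣a-b : + N ∣ᶻ a ℤ.- b
  open _≈_ public

  ≈-refl : a ≈ a
  ≈-refl {a} = mk≈ (ℤ∣.divides 0ℤ (ℤᵖ.+-inverseʳ a))

  ≈-reflexive : a ≡ b → a ≈ b
  ≈-reflexive refl = ≈-refl

  ≈-sym : a ≈ b → b ≈ a
  ≈-sym {a} {b} (mk≈ N∣a-b) = mk≈ (subst (+ N ∣ᶻ_) (neg-minus a b) (ℤ∣.∣m⇒∣-m N∣a-b))
    where
      neg-minus : ∀ a b → ℤ.- (a ℤ.- b) ≡ b ℤ.- a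
      neg-minus = solve-∀

  -‿cong₂ : a ≈ b → c ≈ d → a ℤ.- c ≈ b ℤ.- d
  -‿cong₂ {a} {b} {c} {d} (mk≈ N∣a-b) (mk≈ N∣c-d) =
    mk≈ (subst (+ N ∣ᶻ_) (interchange a b c d) (ℤ∣.∣m∣n⇒∣m-n N∣a-b N∣c-d))
    where
      interchange : ∀ a b c d → (a ℤ.- b) ℤ.- (c ℤ.- d) ≡ (a ℤ.- c) ℤ.- (b ℤ.- d)
      interchange = solve-∀

  ∣-resp-≈ : m ∣ N → a ≈ b → + m ∣ᶻ a → + m ∣ᶻ b
  ∣-resp-≈ {m} {a} {b} m∣N (mk≈ N∣a-b) m∣a =
    subst (+ m ∣ᶻ_) (a-[a-b]≡b a b) (ℤ∣.∣m∣n⇒∣m-n m∣a (ℤ∣.∣-trans (ℤ∣.∣ᵤ⇒∣ m∣N) N∣a-b))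
    where
      a-[a-b]≡b : ∀ a b → a ℤ.- (a ℤ.- b) ≡ b
      a-[a-b]≡b = solve-∀

  δ-≈ : ∀ {x y : Fin N} {s t} → + toℕ x ≈ s → + toℕ y ≈ t → δ x y ≈ s ℤ.- t
  δ-≈ = -‿cong₂

  module _ .{{_ : NonZero N}} where

    fromℤ : ℤ → Fin N
    fromℤ a = fromℕ< (n%ℕd<d a N)

    fromℤ-≈ : ∀ a → + toℕ (fromℤ a) ≈ a
    fromℤ-≈ a rewrite toℕ-fromℕ< (n%ℕd<d a N) = mk≈ (ℤ∣.divides (ℤ.- (a /ℕ N)) (begin
      + r ℤ.- a                         ≡⟨ cong (λ t → + r ℤ.- t) (a≡a%ℕn+[a/ℕn]*n a N) ⟩
      + r ℤ.- (+ r ℤ.+ q ℤ.* + N)       ≡⟨ r-[r+qN]≡-qN (+ r) q (+ N) ⟩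
      ℤ.- q ℤ.* + N                     ∎))
      where
        open ≡-Reasoning
        r = a %ℕ N
        q = a /ℕ N
        r-[r+qN]≡-qN : ∀ r q n → r ℤ.- (r ℤ.+ q ℤ.* n) ≡ ℤ.- q ℤ.* n
        r-[r+qN]≡-qN = solve-∀

-- PowIsId N z k computes to N ∣ k * toℕ z + 0 (the + 0 comes from subtracting + 0 in ℤ).
powIsId⇒∣ : ∀ {N} k (z : Fin N) → PowIsId N z k → N ∣ k * toℕ z
powIsId⇒∣ {N} k z = subst (N ∣_) (+-identityʳ (k * toℕ z))

∣⇒powIsId : ∀ {N} k (z : Fin N) → N ∣ k * toℕ z → PowIsId N z k
∣⇒powIsId {N} k z = subst (N ∣_) (sym (+-identityʳ (k * toℕ z)))

module PrimeSquareFactor {N p e : ℕ} .{{_ : NonZero N}}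
         (p-prime : Prime p) (p⊥e : Coprime p e) (N≡p²e : N ≡ p ^ 2 * e) where

  open Modulo N

  private instance
    p≢0 : NonZero p
    p≢0 = prime⇒nonZero p-prime

    p²≢0 : NonZero (p ^ 2)
    p²≢0 = m^n≢0 p 2

  p²∣N : p ^ 2 ∣ N
  p²∣N = subst (p ^ 2 ∣_) (sym N≡p²e) (m∣m*n e)

  p∣N : p ∣ N
  p∣N = ∣-trans (m∣m*n (p ^ 1)) p²∣N

  e∣N : e ∣ N
  e∣N = subst (e ∣_) (sym N≡p²e) (n∣m*n (p ^ 2))

  hasOrder⇒ : ∀ {z : Fin N} → HasOrder N z (p ^ 2) → e ∣ toℕ z × ¬ p ∣ toℕ z
  hasOrder⇒ {z} (_ , p²-power , least) = e∣z , p∤z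
    where
      e∣z : e ∣ toℕ z
      e∣z = *-cancelˡ-∣ (p ^ 2) (subst (_∣ p ^ 2 * toℕ z) N≡p²e (powIsId⇒∣ (p ^ 2) z p²-power))
      p∤z : ¬ p ∣ toℕ z
      p∤z p∣z = <⇒≱ (p<p^2 p-prime) (least p (>-nonZero⁻¹ p) (∣⇒powIsId p z N∣pz))
        where
          reassociate : ∀ p e → p * (p * 1) * e ≡ p * (p * e)
          reassociate = ℕ-Solver.solve-∀
          N∣pz : N ∣ p * toℕ z
          N∣pz = subst (_∣ p * toℕ z) (sym (trans N≡p²e (reassociate p e)))
                   (*-monoʳ-∣ p (coprime⇒*∣ p⊥e p∣z e∣z))

  hasOrder⇐ : ∀ {z : Fin N} → e ∣ toℕ z → ¬ p ∣ toℕ z → HasOrder N z (p ^ 2)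
  hasOrder⇐ {z} e∣z p∤z = m^n>0 p 2 , ∣⇒powIsId (p ^ 2) z N∣p²z , least
    where
      N∣p²z : N ∣ p ^ 2 * toℕ z
      N∣p²z = subst (_∣ p ^ 2 * toℕ z) (sym N≡p²e) (*-monoʳ-∣ (p ^ 2) e∣z)
      least : ∀ j → 0 < j → PowIsId N z j → p ^ 2 ≤ j
      least j j>0 N∣jz = ∣⇒≤ {{>-nonZero j>0}} (coprime-divisor p²⊥z p²∣zj)
        where
          p²⊥z = coprime-^ˡ 2 (∤⇒coprime p-prime p∤z)
          p²∣zj : p ^ 2 ∣ toℕ z * j
          p²∣zj = subst (p ^ 2 ∣_) (*-comm j (toℕ z)) (∣-trans p²∣N (powIsId⇒∣ j z N∣jz))

  quotient-divisibility : ∀ {x y z : Fin N} → HasOrder N z (p ^ 2) → IsQuot N x y z →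
                          + e ∣ᶻ δ x y × ¬ + p ∣ᶻ δ x y
  quotient-divisibility {x} {y} {z} z-order x/y≡z =
    ∣-resp-≈ e∣N z≈δ (ℤ∣.∣ᵤ⇒∣ e∣z) , p∤z ∘ ℤ∣.∣⇒∣ᵤ ∘ ∣-resp-≈ p∣N (≈-sym z≈δ)
    where
      z≈δ : + toℕ z ≈ δ x y
      z≈δ = mk≈ (ℤ∣.∣ᵤ⇒∣ x/y≡z)
      e∣z = hasOrder⇒ z-order .proj₁
      p∤z = hasOrder⇒ z-order .proj₂

  module _ {Adj : Fin N → Fin N → Set}
           (edge : ∀ {x y z} → x ≢ y → HasOrder N z (p ^ 2) → IsQuot N x y z → Adj x y) where

    adjacent : ∀ {x y s t} → + toℕ x ≈ s → + toℕ y ≈ t →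
               + e ∣ᶻ s ℤ.- t → ¬ + p ∣ᶻ s ℤ.- t → Adj x y
    adjacent {x} {y} x≈s y≈t e∣s-t p∤s-t = edge x≢y (hasOrder⇐ e∣z p∤z) (ℤ∣.∣⇒∣ᵤ (fromℤ-≈ (δ x y) .N∣a-b))
      where
        δ≈s-t = δ-≈ x≈s y≈t
        z = fromℤ (δ x y)
        x≢y : x ≢ y
        x≢y refl = p∤s-t (∣-resp-≈ p∣N δ≈s-t
                     (subst (+ p ∣ᶻ_) (sym (ℤᵖ.+-inverseʳ (+ toℕ x))) (ℤ∣.divides 0ℤ refl)))
        e∣z : e ∣ toℕ z
        e∣z = ℤ∣.∣⇒∣ᵤ (∣-resp-≈ e∣N (≈-sym (fromℤ-≈ (δ x y))) (∣-resp-≈ e∣N (≈-sym δ≈s-t) e∣s-t))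
        p∤z : ¬ p ∣ toℕ z
        p∤z = p∤s-t ∘ ∣-resp-≈ p∣N δ≈s-t ∘ ∣-resp-≈ p∣N (fromℤ-≈ (δ x y)) ∘ ℤ∣.∣ᵤ⇒∣

    walk≤2 : ∀ {x y s t} → + toℕ x ≈ s → + toℕ y ≈ t → + e ∣ᶻ s ℤ.- t → WalkWithin Adj 2 x y
    walk≤2 {x} {y} {s} {t} x≈s y≈t e∣s-t with + p ∣ᶻ? s ℤ.- t
    ... | no p∤s-t = 1 , s≤s z≤n , there (adjacent x≈s y≈t e∣s-t p∤s-t) here
    ... | yes p∣s-t = 2 , ≤-refl ,
          there (adjacent x≈s (fromℤ-≈ (t ℤ.+ + e)) e∣s-[t+e] p∤s-[t+e])
                (there (adjacent (fromℤ-≈ (t ℤ.+ + e)) y≈t e∣[t+e]-t p∤[t+e]-t) here)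
      where
        p∤e : ¬ + p ∣ᶻ + e
        p∤e = coprime⇒∤ p-prime p⊥e ∘ ℤ∣.∣⇒∣ᵤ
        s-[t+e]≡s-t-e : ∀ s t e → s ℤ.- (t ℤ.+ e) ≡ s ℤ.- t ℤ.- e
        s-[t+e]≡s-t-e = solve-∀
        [s-t]-[s-[t+e]]≡e : ∀ s t e → s ℤ.- t ℤ.- (s ℤ.- (t ℤ.+ e)) ≡ e
        [s-t]-[s-[t+e]]≡e = solve-∀
        e∣[t+e]-t : + e ∣ᶻ t ℤ.+ + e ℤ.- t
        e∣[t+e]-t = ℤ∣.∣-reflexive (sym ([i+j]-i≡j t (+ e)))
        p∤[t+e]-t : ¬ + p ∣ᶻ t ℤ.+ + e ℤ.- t
        p∤[t+e]-t = p∤e ∘ subst (+ p ∣ᶻ_) ([i+j]-i≡j t (+ e))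
        e∣s-[t+e] : + e ∣ᶻ s ℤ.- (t ℤ.+ + e)
        e∣s-[t+e] = subst (+ e ∣ᶻ_) (sym (s-[t+e]≡s-t-e s t (+ e))) (ℤ∣.∣m∣n⇒∣m-n e∣s-t ℤ∣.∣-refl)
        p∤s-[t+e] : ¬ + p ∣ᶻ s ℤ.- (t ℤ.+ + e)
        p∤s-[t+e] p∣ = p∤e (subst (+ p ∣ᶻ_) ([s-t]-[s-[t+e]]≡e s t (+ e)) (ℤ∣.∣m∣n⇒∣m-n p∣s-t p∣))

-- The distance from 0 to a in the Cayley graph of ℤ/p² whose connection set is the units.
unitDistance : ℕ → ℤ → ℕ
unitDistance p a = if does (+ (p ^ 2) ∣ᶻ? a) then 0 else if does (+ p ∣ᶻ? a) then 2 else 1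

p∣p² : ∀ p → + p ∣ᶻ + (p ^ 2)
p∣p² p = ℤ∣.∣ᵤ⇒∣ (m∣m*n (p ^ 1))

unitDistance-resp : ∀ p {a b} → + (p ^ 2) ∣ᶻ a ℤ.- b → unitDistance p a ≡ unitDistance p b
unitDistance-resp p {a} {b} p²∣a-b =
  cong₂ (λ s t → if s then 0 else if t then 2 else 1) (same-does (p ^ 2) ∣-refl) (same-does p (m∣m*n (p ^ 1)))
  where
    open Modulo (p ^ 2)
    a≈b : a ≈ b
    a≈b = mk≈ p²∣a-b
    same-does : ∀ m → m ∣ p ^ 2 → does (+ m ∣ᶻ? a) ≡ does (+ m ∣ᶻ? b)
    same-does m m∣p² = does-⇔ (mk⇔ (∣-resp-≈ m∣p² a≈b) (∣-resp-≈ m∣p² (≈-sym a≈b))) (+ m ∣ᶻ? a) (+ m ∣ᶻ? b)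

unitDistance-fixed : ∀ p {a b e} → p ^ 2 ∣ e → + e ∣ᶻ a ℤ.- b → unitDistance p b ≤ unitDistance p a
unitDistance-fixed p {a} {b} p²∣e e∣a-b =
  ≤-reflexive (sym (unitDistance-resp p {a} {b} (ℤ∣.∣-trans (ℤ∣.∣ᵤ⇒∣ p²∣e) e∣a-b)))

unitDistance≤2 : ∀ p a → unitDistance p a ≤ 2
unitDistance≤2 p a = bound (does (+ (p ^ 2) ∣ᶻ? a)) (does (+ p ∣ᶻ? a))
  where
    bound : ∀ s t → (if s then 0 else if t then 2 else 1) ≤ 2
    bound true  _     = z≤n
    bound false true  = ≤-refl
    bound false false = s≤s z≤n

unitDistance-unit : ∀ p {a} → ¬ + p ∣ᶻ a → unitDistance p a ≡ 1
unitDistance-unit p {a} p∤a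
  rewrite dec-false (+ (p ^ 2) ∣ᶻ? a) (p∤a ∘ ℤ∣.∣-trans (p∣p² p)) | dec-false (+ p ∣ᶻ? a) p∤a = refl

unitDistance-step : ∀ p {a b} → ¬ + p ∣ᶻ a ℤ.- b → unitDistance p b ≤ suc (unitDistance p a)
unitDistance-step p {a} {b} p∤a-b with + (p ^ 2) ∣ᶻ? a
... | yes p²∣a rewrite dec-true (+ (p ^ 2) ∣ᶻ? a) p²∣a =
  ≤-reflexive (unitDistance-unit p (p∤a-b ∘ ℤ∣.∣m∣n⇒∣m-n (ℤ∣.∣-trans (p∣p² p) p²∣a)))
... | no p²∤a rewrite dec-false (+ (p ^ 2) ∣ᶻ? a) p²∤a =
  ≤-trans (unitDistance≤2 p b) (s≤s (positive (does (+ p ∣ᶻ? a))))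
  where
    positive : ∀ t → 1 ≤ (if t then 2 else 1)
    positive true  = s≤s z≤n
    positive false = s≤s z≤n

unitDistance-zero : ∀ p → unitDistance p 0ℤ ≡ 0
unitDistance-zero p rewrite dec-true (+ (p ^ 2) ∣ᶻ? 0ℤ) (ℤ∣.divides 0ℤ refl) = refl

p²∤p* : Prime p → Coprime p m → ¬ p ^ 2 ∣ p * m
p²∤p* {p} {m} p-prime p⊥m p²∣pm = coprime⇒∤ p-prime p⊥m
  (subst (_∣ m) (*-identityʳ p) (*-cancelˡ-∣ p {{prime⇒nonZero p-prime}} p²∣pm))

unitDistance-p* : Prime p → Coprime p m → unitDistance p (+ (p * m)) ≡ 2
unitDistance-p* {p} {m} p-prime p⊥m
  rewrite dec-false (+ (p ^ 2) ∣ᶻ? + (p * m)) (p²∤p* p-prime p⊥m ∘ ℤ∣.∣⇒∣ᵤ)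
        | dec-true (+ p ∣ᶻ? + (p * m)) (ℤ∣.∣ᵤ⇒∣ (m∣m*n m)) = refl

module Diameter (α β γ : ℕ) (α-prime : Prime α) (β-prime : Prime β) (γ-prime : Prime γ)
                (α<β : α < β) (β<γ : β < γ) where

  N = α ^ 2 * β ^ 2 * γ ^ 2
  eα = β ^ 2 * γ ^ 2
  eβ = α ^ 2 * γ ^ 2
  eγ = α ^ 2 * β ^ 2

  instance
    α≢0 : NonZero α
    α≢0 = prime⇒nonZero α-prime
    β≢0 : NonZero β
    β≢0 = prime⇒nonZero β-prime
    N≢0 : NonZero N
    N≢0 = m*n≢0 (α ^ 2 * β ^ 2) (γ ^ 2) {{m*n≢0 _ _ {{m^n≢0 α 2}} {{m^n≢0 β 2}}}}
                {{m^n≢0 γ 2 {{prime⇒nonZero γ-prime}}}}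

  α⊥β : Coprime α β
  α⊥β = coprime-sym (prime⇒coprime β-prime α<β)
  α⊥γ : Coprime α γ
  α⊥γ = coprime-sym (prime⇒coprime γ-prime (<-trans α<β β<γ))
  β⊥γ : Coprime β γ
  β⊥γ = coprime-sym (prime⇒coprime γ-prime β<γ)

  α⊥eα : Coprime α eα
  α⊥eα = coprime-*ʳ (coprime-^ʳ 2 α⊥β) (coprime-^ʳ 2 α⊥γ)
  β⊥eβ : Coprime β eβ
  β⊥eβ = coprime-*ʳ (coprime-^ʳ 2 (coprime-sym α⊥β)) (coprime-^ʳ 2 β⊥γ)
  γ⊥eγ : Coprime γ eγ
  γ⊥eγ = coprime-*ʳ (coprime-^ʳ 2 (coprime-sym α⊥γ)) (coprime-^ʳ 2 (coprime-sym β⊥γ))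

  N≡β²eβ : N ≡ β ^ 2 * eβ
  N≡β²eβ = rotate (α ^ 2) (β ^ 2) (γ ^ 2)
    where
      rotate : ∀ a b c → a * b * c ≡ b * (a * c)
      rotate = ℕ-Solver.solve-∀

  module Pα = PrimeSquareFactor α-prime α⊥eα (*-assoc (α ^ 2) (β ^ 2) (γ ^ 2))
  module Pβ = PrimeSquareFactor β-prime β⊥eβ N≡β²eβ
  module Pγ = PrimeSquareFactor γ-prime γ⊥eγ (*-comm (α ^ 2 * β ^ 2) (γ ^ 2))

  open Modulo N

  G = CayAdj α β γ N

  Φ : ℤ → ℕ
  Φ a = unitDistance α a + unitDistance β a + unitDistance γ a

  Φ-resp : a ≈ b → Φ a ≡ Φ b
  Φ-resp {a} {b} (mk≈ N∣a-b) = cong₂ _+_ (cong₂ _+_ (resp α Pα.p²∣N) (resp β Pβ.p²∣N)) (resp γ Pγ.p²∣N)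
    where
      resp : ∀ p → p ^ 2 ∣ N → unitDistance p a ≡ unitDistance p b
      resp p p²∣N = unitDistance-resp p {a} {b} (ℤ∣.∣-trans (ℤ∣.∣ᵤ⇒∣ p²∣N) N∣a-b)

  Φ-step-α : ∀ {a b} → + eα ∣ᶻ a ℤ.- b → ¬ + α ∣ᶻ a ℤ.- b → Φ b ≤ suc (Φ a)
  Φ-step-α {a} {b} eα∣a-b α∤a-b =
    +-mono-≤ (+-mono-≤ (unitDistance-step α {a} {b} α∤a-b)
                       (unitDistance-fixed β {a} {b} (m∣m*n (γ ^ 2)) eα∣a-b))
             (unitDistance-fixed γ {a} {b} (n∣m*n (β ^ 2)) eα∣a-b)

  Φ-step-β : ∀ {a b} → + eβ ∣ᶻ a ℤ.- b → ¬ + β ∣ᶻ a ℤ.- b → Φ b ≤ suc (Φ a)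
  Φ-step-β {a} {b} eβ∣a-b β∤a-b = ≤-trans
    (+-mono-≤ (+-mono-≤ (unitDistance-fixed α {a} {b} (m∣m*n (γ ^ 2)) eβ∣a-b)
                        (unitDistance-step β {a} {b} β∤a-b))
              (unitDistance-fixed γ {a} {b} (n∣m*n (α ^ 2)) eβ∣a-b))
    (≤-reflexive (cong (_+ unitDistance γ a) (+-suc (unitDistance α a) (unitDistance β a))))

  Φ-step-γ : ∀ {a b} → + eγ ∣ᶻ a ℤ.- b → ¬ + γ ∣ᶻ a ℤ.- b → Φ b ≤ suc (Φ a)
  Φ-step-γ {a} {b} eγ∣a-b γ∤a-b = ≤-trans
    (+-mono-≤ (+-mono-≤ (unitDistance-fixed α {a} {b} (m∣m*n (β ^ 2)) eγ∣a-b)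
                        (unitDistance-fixed β {a} {b} (n∣m*n (α ^ 2)) eγ∣a-b))
              (unitDistance-step γ {a} {b} γ∤a-b))
    (≤-reflexive (+-suc (unitDistance α a + unitDistance β a) (unitDistance γ a)))

  potential-step : ∀ {x y} → G x y → Φ (+ toℕ y) ≤ suc (Φ (+ toℕ x))
  potential-step {x} {y} (_ , _ , (_ , inj₁ refl , z-order) , x/y≡z) =
    uncurry (Φ-step-α {+ toℕ x} {+ toℕ y}) (Pα.quotient-divisibility {x} {y} z-order x/y≡z)
  potential-step {x} {y} (_ , _ , (_ , inj₂ (inj₁ refl) , z-order) , x/y≡z) =
    uncurry (Φ-step-β {+ toℕ x} {+ toℕ y}) (Pβ.quotient-divisibility {x} {y} z-order x/y≡z)
  potential-step {x} {y} (_ , _ , (_ , inj₂ (inj₂ refl) , z-order) , x/y≡z) =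
    uncurry (Φ-step-γ {+ toℕ x} {+ toℕ y}) (Pγ.quotient-divisibility {x} {y} z-order x/y≡z)

  origin antipode : Fin N
  origin = fromℤ 0ℤ
  antipode = fromℤ (+ (α * β * γ))

  Φ-origin : Φ (+ toℕ origin) ≡ 0
  Φ-origin = trans (Φ-resp (fromℤ-≈ 0ℤ))
    (cong₂ _+_ (cong₂ _+_ (unitDistance-zero α) (unitDistance-zero β)) (unitDistance-zero γ))

  Φ-antipode : Φ (+ toℕ antipode) ≡ 6
  Φ-antipode = trans (Φ-resp (fromℤ-≈ (+ (α * β * γ))))
    (cong₂ _+_ (cong₂ _+_ (two α-prime (*-assoc α β γ) (coprime-*ʳ α⊥β α⊥γ))
                          (two β-prime (swap α β γ) (coprime-*ʳ (coprime-sym α⊥β) β⊥γ)))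
               (two γ-prime (*-comm (α * β) γ) (coprime-*ʳ (coprime-sym α⊥γ) (coprime-sym β⊥γ))))
    where
      swap : ∀ a b c → a * b * c ≡ b * (a * c)
      swap = ℕ-Solver.solve-∀
      two : ∀ {p m} → Prime p → α * β * γ ≡ p * m → Coprime p m → unitDistance p (+ (α * β * γ)) ≡ 2
      two {p} p-prime αβγ≡pm p⊥m =
        trans (cong (λ k → unitDistance p (+ k)) αβγ≡pm) (unitDistance-p* p-prime p⊥m)

  antipode-distance : ∀ m → Walk G origin antipode m → 6 ≤ m
  antipode-distance m w = begin
    6                        ≡⟨ Φ-antipode ⟨
    Φ (+ toℕ antipode)       ≤⟨ walk-potential (λ v → Φ (+ toℕ v)) potential-step w ⟩
    m + Φ (+ toℕ origin)     ≡⟨ cong (λ k → m + k) Φ-origin ⟩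
    m + 0                    ≡⟨ +-identityʳ m ⟩
    m                        ∎
    where open ≤-Reasoning

  edge-α : ∀ {x y z} → x ≢ y → HasOrder N z (α ^ 2) → IsQuot N x y z → G x y
  edge-α x≢y z-order x/y≡z = x≢y , _ , (_ , inj₁ refl , z-order) , x/y≡z

  edge-β : ∀ {x y z} → x ≢ y → HasOrder N z (β ^ 2) → IsQuot N x y z → G x y
  edge-β x≢y z-order x/y≡z = x≢y , _ , (_ , inj₂ (inj₁ refl) , z-order) , x/y≡z

  edge-γ : ∀ {x y z} → x ≢ y → HasOrder N z (γ ^ 2) → IsQuot N x y z → G x y
  edge-γ x≢y z-order x/y≡z = x≢y , _ , (_ , inj₂ (inj₂ refl) , z-order) , x/y≡z

  vertex-decomposition : ∀ (x y : Fin N) →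
    ∃[ Tα ] ∃[ Tβ ] ∃[ Tγ ] + toℕ x ≡ + toℕ y ℤ.+ + eα ℤ.* Tα ℤ.+ + eβ ℤ.* Tβ ℤ.+ + eγ ℤ.* Tγ
  vertex-decomposition x y =
    let Tα , Tβ , Tγ , δ≡ = cofactor-decomposition {α ^ 2} {β ^ 2} {γ ^ 2}
                               (coprime-^ˡ 2 α⊥eα) (coprime-^ˡ 2 (coprime-^ʳ 2 β⊥γ)) (δ x y)
        A = + eα ℤ.* Tα
        B = + eβ ℤ.* Tβ
        C = + eγ ℤ.* Tγ
    in Tα , Tβ , Tγ , (begin
      + toℕ x                      ≡⟨ x≡y+[x-y] (+ toℕ x) (+ toℕ y) ⟩
      + toℕ y ℤ.+ δ x y            ≡⟨ cong (λ d → + toℕ y ℤ.+ d) δ≡ ⟩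
      + toℕ y ℤ.+ (A ℤ.+ B ℤ.+ C)  ≡⟨ reassociate (+ toℕ y) A B C ⟩
      + toℕ y ℤ.+ A ℤ.+ B ℤ.+ C    ∎)
    where
      open ≡-Reasoning
      x≡y+[x-y] : ∀ x y → x ≡ y ℤ.+ (x ℤ.- y)
      x≡y+[x-y] = solve-∀
      reassociate : ∀ y a b c → y ℤ.+ (a ℤ.+ b ℤ.+ c) ≡ y ℤ.+ a ℤ.+ b ℤ.+ c
      reassociate = solve-∀

  walk≤6-via : ∀ {x y} Tα Tβ Tγ → + toℕ x ≈ + toℕ y ℤ.+ + eα ℤ.* Tα ℤ.+ + eβ ℤ.* Tβ ℤ.+ + eγ ℤ.* Tγ →
               WalkWithin G 6 x y
  walk≤6-via {x} {y} Tα Tβ Tγ x≈t₁+C =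
    within-++
      (Pγ.walk≤2 edge-γ {x} {v₁} {t₁ ℤ.+ + eγ ℤ.* Tγ} {t₁} x≈t₁+C (fromℤ-≈ t₁) (e∣[t+eT]-t {eγ} t₁ Tγ))
      (within-++
        (Pβ.walk≤2 edge-β {v₁} {v₂} {t₁} {t₂} (fromℤ-≈ t₁) (fromℤ-≈ t₂) (e∣[t+eT]-t {eβ} t₂ Tβ))
        (Pα.walk≤2 edge-α {v₂} {y} {t₂} {+ toℕ y} (fromℤ-≈ t₂) ≈-refl (e∣[t+eT]-t {eα} (+ toℕ y) Tα)))
    where
      t₂ = + toℕ y ℤ.+ + eα ℤ.* Tα
      t₁ = t₂ ℤ.+ + eβ ℤ.* Tβ
      v₁ = fromℤ t₁
      v₂ = fromℤ t₂

  walk≤6 : ∀ x y → WalkWithin G 6 x y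
  walk≤6 x y = let Tα , Tβ , Tγ , x≡ = vertex-decomposition x y in walk≤6-via Tα Tβ Tγ (≈-reflexive x≡)

proposition2p19 : (α β γ : ℕ) → Prime α → Prime β → Prime γ →
                  α < β → β < γ →
                  HasDiameter (CayAdj α β γ ((α ^ 2) * (β ^ 2) * (γ ^ 2))) 6
proposition2p19 α β γ α-prime β-prime γ-prime α<β β<γ =
  walk≤6 , origin , antipode , antipode-distance
  where open Diameter α β γ α-prime β-prime γ-prime α<β β<γ
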